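{- Let $\alpha\subseteq\{+,-\}$ with $\alpha\neq\emptyset$, $s\in\mathbb{N}$, $\mathcal{C}=\mathcal{C}_{\alpha,s}$, and let $F$ be a CNF formula. A set $T$ is a $\mathcal{C}$-obstruction tree of depth $d$ in $F$ if and only if there is a connected component $F'$ of $F$ such that $T$ is a $\mathcal{C}$-obstruction tree of depth $d$ in $F'$.
   Context: A clause is a finite set of literals with no complementary pair; a CNF formula is a finite set of clauses. For a partial assignment $\beta$, $F[\beta]$ is obtained by deleting clauses containing a true literal and deleting false literals from the remaining clauses. Paths and connected components of $F$ refer to its incidence graph (bipartite graph between variables and clauses, $x$ adjacent to $c$ iff $x$ or $\neg x$ is in $c$); a connected component is a maximal connected subset of clauses. A literal is an $\alpha$-literal if it is positive and $+\in\alpha$, or negative and $-\in\alpha$; $\mathcal{C}_{\alpha,s}$ is the class of CNF formulas each clause of which has at most $s$ $\alpha$-literals; a clause $c$ is $\mathcal{C}$-bad if $\{c\}\notin\mathcal{C}$. $\mathcal{C}$-obstruction trees are defined inductively: if $c$ is a $\mathcal{C}$-bad clause of $F$, then $\{c\}$ is a $\mathcal{C}$-obstruction tree in $F$ of depth 0. If $T_1$ is a $\mathcal{C}$-obstruction tree of depth $i$ in $F$, $\beta$ is a partial assignment of variables of $F$, $T_2$ is a $\mathcal{C}$-obstruction tree of depth $i$ in $F[\beta]$ such that no variable $v\in\mathit{var}(F[\beta])$ occurs both in a clause of $T_1$ and in a clause of $T_2$, and $P$ (a set of clauses representing a path) is a path in $F$ connecting $T_1$ and $T_2$, then $T_1\cup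 T_2\cup\mathit{var}(P)\cup P$ is a $\mathcal{C}$-obstruction tree in $F$ of depth $i+1$. -}

module Defs where

open import Data.Nat using (ℕ; zero; suc; _<ᵇ_; _≤_; _>_)
open import Data.Bool using (Bool; true; false; _∧_; _∨_; T; not)
open import Data.Maybe using (Maybe; just; nothing; is-nothing)
open import Data.List using (List; []; _∷_; map; filter; length)
open import Data.List.Membership.Propositional using (_∈_)
open import Data.Product using (Σ; ∃; _×_; _,_; proj₁; proj₂)
open import Data.Sum using (_⊎_; inj₁; inj₂)
open import Relation.Nullary using (¬_)
open import Relation.Binary.PropositionalEquality using (_≡_)

Var : Set
Var = ℕ

-- A literal is a variable together with a polarity (true = positive).
Lit : Set
Lit = Var × Bool

litVar : Lit → Var
litVar = proj₁

incr : List ℕ → Bool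
incr [] = true
incr (x ∷ []) = true
incr (x ∷ y ∷ r) = (x <ᵇ y) ∧ incr (y ∷ r)

-- Canonical representation: a list of literals whose variables are
-- strictly increasing.  This excludes duplicates and complementary pairs,
-- and makes propositional equality of clauses coincide with set equality
-- (the well-formedness proof lives in ⊤, which has η).
Clause : Set
Clause = Σ (List Lit) (λ ls → T (incr (map litVar ls)))

lits : Clause → List Lit
lits = proj₁

vars : Clause → List Var
vars c = map litVar (lits c)

-- A CNF formula is a set of clauses (as a predicate); finiteness is
-- imposed separately where needed.
Formula : Set₁
Formula = Clause → Set

Finite : Formula → Set
Finite F = Σ (List Clause) (λ L → ∀ c → F c → c ∈ L)

_∈var_ : Var → Formula → Set
v ∈var F = ∃ λ c → F c × v ∈ vars c

PAssign : Set
PAssign = Var → Maybe Bool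

IsPAssignOf : Formula → PAssign → Set
IsPAssignOf F β = ∀ v b → β v ≡ just b → v ∈var F

Sat : PAssign → Clause → Set
Sat β c = ∃ λ l → l ∈ lits c × β (proj₁ l) ≡ just (proj₂ l)

unassigned : PAssign → Lit → Bool
unassigned β l = is-nothing (β (proj₁ l))

-- F[β]: delete satisfied clauses, delete false literals from the others
-- (for a non-satisfied clause, the remaining literals are exactly the
-- unassigned ones).
_[_] : Formula → PAssign → Formula
(F [ β ]) c = ∃ λ c' → F c' × ¬ Sat β c' × lits c ≡ filterᵇ (lits c')
  where
  filterᵇ : List Lit → List Lit
  filterᵇ [] = []
  filterᵇ (l ∷ ls) with unassigned β l
  ... | true  = l ∷ filterᵇ ls
  ... | false = filterᵇ ls

-- A path in the incidence graph of F from variable x to variable z,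
-- passing through the listed clauses (x c₁ x₁ c₂ … cₖ z); the list
-- of clauses is the set P representing the path.  k = 0 allowed
-- (the trivial path at x).
data Path (F : Formula) : Var → List Clause → Var → Set where
  stop : ∀ x → Path F x [] x
  step : ∀ {x y z c ps} → F c → x ∈ vars c → y ∈ vars c →
         Path F y ps z → Path F x (c ∷ ps) z

data Linked (G : Formula) : Clause → Clause → Set where
  here : ∀ {c} → G c → Linked G c c
  next : ∀ {c c' d v} → G c → v ∈ vars c → v ∈ vars c' →
         Linked G c' d → Linked G c d

Connected : Formula → Set
Connected G = ∀ c d → G c → G d → Linked G c d

_⊆_ : Formula → Formula → Set
G ⊆ H = ∀ c → G c → H c

IsComponent : Formula → Formula → Set₁
IsComponent F F' =
  F' ⊆ F × (∃ λ c → F' c) × Connected F' ×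
  (∀ (G : Formula) → F' ⊆ G → G ⊆ F → Connected G → G ⊆ F')

-- α ⊆ {+,-} given by membership flags (plus , minus)
Sign : Set
Sign = Bool × Bool

NonEmptySign : Sign → Set
NonEmptySign (p , m) = T (p ∨ m)

isαLit : Sign → Lit → Bool
isαLit (p , m) (_ , true)  = p
isαLit (p , m) (_ , false) = m

αcount : Sign → Clause → ℕ
αcount α c = length (filter (λ l → T? (isαLit α l)) (lits c))
  where open import Data.Bool.Properties using (T?)

InC : Sign → ℕ → Formula → Set
InC α s F = ∀ c → F c → αcount α c ≤ s

BadC : Sign → ℕ → Clause → Set
BadC α s c = ¬ InC α s (λ d → d ≡ c)

VSet : Set₁
VSet = Clause ⊎ Var → Set

OccIn : VSet → Var → Set
OccIn T v = ∃ λ c → T (inj₁ c) × v ∈ vars c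

data ObstructionTree (Bad : Clause → Set) : Formula → ℕ → VSet → Set₁ where
  base : ∀ {F T} (c : Clause) → F c → Bad c →
         (∀ x → (T x → x ≡ inj₁ c) × (x ≡ inj₁ c → T x)) →
         ObstructionTree Bad F 0 T
  join : ∀ {F i T} (T₁ T₂ : VSet) (β : PAssign) → IsPAssignOf F β →
         ObstructionTree Bad F i T₁ →
         ObstructionTree Bad (F [ β ]) i T₂ →
         (∀ v → v ∈var (F [ β ]) → ¬ (OccIn T₁ v × OccIn T₂ v)) →
         (x z : Var) (P : List Clause) → Path F x P z →
         OccIn T₁ x → OccIn T₂ z →
         (∀ y → let U = T₁ y ⊎ T₂ y ⊎ (∃ λ v → y ≡ inj₂ v × ∃ λ c → c ∈ P × v ∈ vars c)
                                   ⊎ (∃ λ c → y ≡ inj₁ c × c ∈ P)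
                in (T y → U) × (U → T y)) →
         ObstructionTree Bad F (suc i) T

{-# OPTIONS --safe #-}
-- Every obstruction tree in F is assembled from finitely many clauses of F, its support, where a
-- clause of a subtree in F[β] is represented by the clause of F it was cut from; the path joining
-- the two subtrees makes the support connected in F. Conversely, a tree stays a tree in any formula
-- containing its support, provided each assignment β is restricted to the variables of the support:
-- the restriction is an assignment of the smaller formula and cuts the support clauses exactly as β
-- does. So T is a tree in the component of any of its support clauses, and a tree in a component is
-- a tree in F.
module Submission where

open import Defs
open import Data.Nat using (ℕ; _≟_)
open import Data.Bool using (true; false)
open import Data.Unit using (⊤; tt)
open import Data.Maybe using (just; nothing)
open import Data.Product using (∃; _×_; Σ; _,_; proj₁; proj₂)
open import Data.Sum using (inj₁; inj₂)
open import Data.List using (List; []; _∷_; map; _++_; concatMap)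
open import Data.List.Relation.Unary.Any using (here; there)
open import Data.List.Membership.Propositional using (_∈_; find; lose)
open import Data.List.Membership.Propositional.Properties
  using (∈-map⁺; ∈-map⁻; ∈-++⁺ˡ; ∈-++⁺ʳ; ∈-++⁻; ∈-concatMap⁺; ∈-concatMap⁻)
open import Data.List.Membership.DecPropositional _≟_ using (_∈?_)
open import Function using (_∘_)
open import Relation.Nullary using (¬_; yes; no; contradiction)
open import Relation.Binary.PropositionalEquality using (_≡_; refl; sym; trans; cong; subst)

-- The literal filter of F [ β ] is local to its definition; unification recovers it, so that
-- (F [ β ]) c unfolds to  ∃ λ c' → F c' × ¬ Sat β c' × lits c ≡ residual β (lits c').
filterOf : (β : PAssign) {f : List Lit → List Lit} →
           ((λ _ → ⊤) [ β ]) ([] , tt) ≡ (∃ λ c' → ⊤ × ¬ Sat β c' × [] ≡ f (lits c')) →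
           List Lit → List Lit
filterOf _ {f} _ = f

residual : PAssign → List Lit → List Lit
residual β = filterOf β refl

residual-vars : ∀ β ls {v} → v ∈ map litVar (residual β ls) → v ∈ map litVar ls
residual-vars β [] ()
residual-vars β (l ∷ ls) v∈ with unassigned β l
residual-vars β (l ∷ ls) (here v≡)  | true  = here v≡
residual-vars β (l ∷ ls) (there v∈) | true  = there (residual-vars β ls v∈)
residual-vars β (l ∷ ls) v∈         | false = there (residual-vars β ls v∈)

residual-cong : ∀ {β β'} ls → (∀ {v} → v ∈ map litVar ls → β v ≡ β' v) →
                residual β ls ≡ residual β' ls
residual-cong [] _ = refl
residual-cong {β' = β'} (l ∷ ls) agree rewrite agree (here refl) with unassigned β' l
... | true  = cong (l ∷_) (residual-cong ls (λ v∈ → agree (there v∈)))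
... | false = residual-cong ls (λ v∈ → agree (there v∈))

source : ∀ {G β} → Σ Clause (G [ β ]) → Σ Clause G
source (_ , c' , Gc' , _) = c' , Gc'

source-vars : ∀ {G β} (e : Σ Clause (G [ β ])) {v} →
              v ∈ vars (proj₁ e) → v ∈ vars (proj₁ (source e))
source-vars {β = β} (_ , c' , _ , _ , eq) v∈ =
  residual-vars β (lits c') (subst (λ ls → _ ∈ map litVar ls) eq v∈)

[]-transfer : ∀ {G K β β'} (e : Σ Clause (G [ β ])) → K (proj₁ (source e)) →
              (∀ {v} → v ∈ vars (proj₁ (source e)) → β v ≡ β' v) → (K [ β' ]) (proj₁ e)
[]-transfer (_ , c' , _ , unsat , eq) Kc' agree =
  c' , Kc' , (λ (l , l∈ , βl) → unsat (l , l∈ , trans (agree (∈-map⁺ litVar l∈)) βl)) ,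
  trans eq (residual-cong (lits c') agree)

restrict : PAssign → List Var → PAssign
restrict β Vs v with v ∈? Vs
... | yes _ = β v
... | no  _ = nothing

restrict-agrees : ∀ β {Vs v} → v ∈ Vs → β v ≡ restrict β Vs v
restrict-agrees β {Vs} {v} v∈ with v ∈? Vs
... | yes _  = refl
... | no v∉  = contradiction v∈ v∉

restrict-assigned : ∀ β Vs {v b} → restrict β Vs v ≡ just b → v ∈ Vs
restrict-assigned β Vs {v} βv with v ∈? Vs
... | yes v∈ = v∈

linked-head : ∀ {G c d} → Linked G c d → G c
linked-head (here Gc)       = Gc
linked-head (next Gc _ _ _) = Gc

linked-last : ∀ {G c d} → Linked G c d → G d
linked-last (here Gd)        = Gd
linked-last (next _ _ _ c~d) = linked-last c~d

linked-snoc : ∀ {G c d e v} → Linked G c d → G e → v ∈ vars d → v ∈ vars e → Linked G c e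
linked-snoc (here Gc)            Ge v∈d v∈e = next Gc v∈d v∈e (here Ge)
linked-snoc (next Gc u∈c u∈c' r) Ge v∈d v∈e = next Gc u∈c u∈c' (linked-snoc r Ge v∈d v∈e)

linked-sym : ∀ {G c d} → Linked G c d → Linked G d c
linked-sym (here Gc)               = here Gc
linked-sym (next Gc v∈c v∈c' c'~d) = linked-snoc (linked-sym c'~d) Gc v∈c' v∈c

linked-trans : ∀ {G c d e} → Linked G c d → Linked G d e → Linked G c e
linked-trans (here _)                d~e = d~e
linked-trans (next Gc v∈c v∈c' c'~d) d~e = next Gc v∈c v∈c' (linked-trans c'~d d~e)

linked-mono : ∀ {G H c d} → G ⊆ H → Linked G c d → Linked H c d
linked-mono G⊆H (here Gc)               = here (G⊆H _ Gc)
linked-mono G⊆H (next Gc v∈c v∈c' c'~d) = next (G⊆H _ Gc) v∈c v∈c' (linked-mono G⊆H c'~d)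

-- A common variable is needed: an empty clause of G [ β ] may be cut from unlinked clauses of G.
linked-sources : ∀ {G β v} (e e' : Σ Clause (G [ β ])) → v ∈ vars (proj₁ e) →
                 Linked (G [ β ]) (proj₁ e) (proj₁ e') →
                 Linked G (proj₁ (source e)) (proj₁ (source e'))
linked-sources e e'@(_ , _) v∈ (here _) =
  next (proj₂ (source e)) (source-vars e v∈) (source-vars e' v∈) (here (proj₂ (source e')))
linked-sources e e' v∈ (next {c' = c₁} _ u∈c u∈c₁ c₁~d) =
  next (proj₂ (source e)) (source-vars e u∈c) (source-vars e₁ u∈c₁) (linked-sources e₁ e' u∈c₁ c₁~d)
  where e₁ = c₁ , linked-head c₁~d

linked-within : ∀ {G c₀ c d} → Linked G c₀ c → Linked G c d → Linked (Linked G c₀) c d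
linked-within c₀~c (here _)                = here c₀~c
linked-within c₀~c (next Gc v∈c v∈c' c'~d) =
  next c₀~c v∈c v∈c' (linked-within (linked-snoc c₀~c (linked-head c'~d) v∈c v∈c') c'~d)

linked-isComponent : ∀ {G c} → G c → IsComponent G (Linked G c)
linked-isComponent {c = c} Gc =
  (λ _ → linked-last) , (c , here Gc) ,
  (λ d e c~d c~e → linked-within c~d (linked-trans (linked-sym c~d) c~e)) ,
  λ H c~⊆H H⊆G connH d Hd → linked-mono H⊆G (connH c d (c~⊆H c (here Gc)) Hd)

pathClauses : ∀ {G x P z} → Path G x P z → List (Σ Clause G)
pathClauses (stop _)                = []
pathClauses (step {c = c} Gc _ _ p) = (c , Gc) ∷ pathClauses p

pathClauses-proj₁ : ∀ {G x P z} (p : Path G x P z) → map proj₁ (pathClauses p) ≡ P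
pathClauses-proj₁ (stop _)               = refl
pathClauses-proj₁ (step {c = c} _ _ _ p) = cong (c ∷_) (pathClauses-proj₁ p)

path-transfer : ∀ {G K x P z} (p : Path G x P z) →
                (∀ {e} → e ∈ pathClauses p → K (proj₁ e)) → Path K x P z
path-transfer (stop x)             _  = stop x
path-transfer (step _ x∈c y∈c p) ⊆K =
  step (⊆K (here refl)) x∈c y∈c (path-transfer p (λ e∈ → ⊆K (there e∈)))

linked-pathClauses : ∀ {G h x P z e} → G h → x ∈ vars h → (p : Path G x P z) →
                     e ∈ pathClauses p → Linked G h (proj₁ e)
linked-pathClauses Gh x∈h (step Gc x∈c y∈c p) (here refl) = next Gh x∈h x∈c (here Gc)
linked-pathClauses Gh x∈h (step Gc x∈c y∈c p) (there e∈) =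
  next Gh x∈h x∈c (linked-pathClauses Gc y∈c p e∈)

linked-across-path : ∀ {G h h' x P z} → G h → x ∈ vars h → Path G x P z →
                     G h' → z ∈ vars h' → Linked G h h'
linked-across-path Gh x∈h (stop _)            Gh' x∈h' = next Gh x∈h x∈h' (here Gh')
linked-across-path Gh x∈h (step Gc x∈c y∈c p) Gh' z∈h' =
  next Gh x∈h x∈c (linked-across-path Gc y∈c p Gh' z∈h')

support : ∀ {Bad G d T} → ObstructionTree Bad G d T → List (Σ Clause G)
support (base c Gc _ _)                      = (c , Gc) ∷ []
support (join _ _ _ _ D₁ D₂ _ _ _ _ p _ _ _) = support D₁ ++ pathClauses p ++ map source (support D₂)

support-nonempty : ∀ {Bad G d T} (D : ObstructionTree Bad G d T) → ∃ λ e → e ∈ support D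
support-nonempty (base c Gc _ _) = (c , Gc) , here refl
support-nonempty (join _ _ _ _ D₁ _ _ _ _ _ _ _ _ _) =
  let e , e∈ = support-nonempty D₁ in e , ∈-++⁺ˡ e∈

support-occ : ∀ {Bad G d T v} (D : ObstructionTree Bad G d T) → OccIn T v →
              ∃ λ e → e ∈ support D × v ∈ vars (proj₁ e)
support-occ (base c Gc _ T≡) (c' , Tc' , v∈) with proj₁ (T≡ (inj₁ c')) Tc'
... | refl = (c , Gc) , here refl , v∈
support-occ (join _ _ _ _ D₁ D₂ _ _ _ _ p _ _ T≡) (c , Tc , v∈) with proj₁ (T≡ (inj₁ c)) Tc
... | inj₁ T₁c =
  let e , e∈ , v∈e = support-occ D₁ (c , T₁c , v∈) in e , ∈-++⁺ˡ e∈ , v∈e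
... | inj₂ (inj₁ T₂c) =
  let e , e∈ , v∈e = support-occ D₂ (c , T₂c , v∈)
  in source e , ∈-++⁺ʳ (support D₁) (∈-++⁺ʳ (pathClauses p) (∈-map⁺ source e∈)) , source-vars e v∈e
... | inj₂ (inj₂ (inj₁ (_ , () , _)))
... | inj₂ (inj₂ (inj₂ (_ , refl , c∈P)))
  with ∈-map⁻ proj₁ (subst (c ∈_) (sym (pathClauses-proj₁ p)) c∈P)
...   | e , e∈ , refl = e , ∈-++⁺ʳ (support D₁) (∈-++⁺ˡ e∈) , v∈

occIn-var : ∀ {Bad G d T v} → ObstructionTree Bad G d T → OccIn T v → v ∈var G
occIn-var D occ = let (c , Gc) , _ , v∈c = support-occ D occ in c , Gc , v∈c

support-linked : ∀ {Bad G d T} (D : ObstructionTree Bad G d T) {e e'} →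
                 e ∈ support D → e' ∈ support D → Linked G (proj₁ e) (proj₁ e')
support-linked (base c Gc _ _) (here refl) (here refl) = here Gc
support-linked {G = G} (join _ _ _ _ D₁ D₂ _ _ _ _ p x∈T₁ z∈T₂ _) e∈ e'∈ =
  linked-trans (linked-sym (linked-to-hub e∈)) (linked-to-hub e'∈)
  where
  hub : ∃ λ h → h ∈ support D₁ × _ ∈ vars (proj₁ h)
  hub = support-occ D₁ x∈T₁
  h = proj₁ hub
  linked-to-hub : ∀ {e} → e ∈ support D₁ ++ pathClauses p ++ map source (support D₂) →
                  Linked G (proj₁ h) (proj₁ e)
  linked-to-hub e∈ with ∈-++⁻ (support D₁) e∈
  ... | inj₁ e∈₁ = support-linked D₁ (proj₁ (proj₂ hub)) e∈₁
  ... | inj₂ e∈ with ∈-++⁻ (pathClauses p) e∈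
  ...   | inj₁ e∈p = linked-pathClauses (proj₂ h) (proj₂ (proj₂ hub)) p e∈p
  ...   | inj₂ e∈ with ∈-map⁻ source e∈ | support-occ D₂ z∈T₂
  ...     | e₂ , e₂∈ , refl | g , g∈ , z∈g =
    linked-trans (linked-across-path (proj₂ h) (proj₂ (proj₂ hub)) p (proj₂ (source g)) (source-vars g z∈g))
                 (linked-sources g e₂ z∈g (support-linked D₂ g∈ e₂∈))

transfer : ∀ {Bad G d T} (D : ObstructionTree Bad G d T) (K : Formula) →
           (∀ {e} → e ∈ support D → K (proj₁ e)) → ObstructionTree Bad K d T
transfer (base c _ bad T≡) K ⊆K = base c (⊆K (here refl)) bad T≡
transfer (join T₁ T₂ β _ D₁ D₂ disjoint x z P p x∈T₁ z∈T₂ T≡) K ⊆K =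
  join T₁ T₂ β' assigns (transfer D₁ K (λ e∈ → ⊆K (∈-++⁺ˡ e∈))) (transfer D₂ (K [ β' ]) ⊆K[β'])
       (λ v _ occ → disjoint v (occIn-var D₂ (proj₂ occ)) occ)
       x z P (path-transfer p (λ e∈ → ⊆K (∈-++⁺ʳ (support D₁) (∈-++⁺ˡ e∈)))) x∈T₁ z∈T₂ T≡
  where
  sourceVars = concatMap (vars ∘ proj₁ ∘ source) (support D₂)
  β' = restrict β sourceVars
  source⊆K : ∀ {e} → e ∈ support D₂ → K (proj₁ (source e))
  source⊆K e∈ = ⊆K (∈-++⁺ʳ (support D₁) (∈-++⁺ʳ (pathClauses p) (∈-map⁺ source e∈)))
  assigns : IsPAssignOf K β'
  assigns v _ β'v with find (∈-concatMap⁻ (vars ∘ proj₁ ∘ source) (restrict-assigned β sourceVars β'v))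
  ... | e , e∈ , v∈ = proj₁ (source e) , source⊆K e∈ , v∈
  ⊆K[β'] : ∀ {e} → e ∈ support D₂ → (K [ β' ]) (proj₁ e)
  ⊆K[β'] {e} e∈ = []-transfer e (source⊆K e∈)
    (λ v∈ → restrict-agrees β (∈-concatMap⁺ (vars ∘ proj₁ ∘ source) (lose e∈ v∈)))

obstructionTree-inComponent : ∀ {Bad F d T} → ObstructionTree Bad F d T →
                              ∃ λ F' → IsComponent F F' × ObstructionTree Bad F' d T
obstructionTree-inComponent D =
  let (c₀ , Fc₀) , c₀∈ = support-nonempty D
  in Linked _ c₀ , linked-isComponent Fc₀ , transfer D (Linked _ c₀) (support-linked D c₀∈)

obstructionTree-fromComponent : ∀ {Bad F F' d T} → IsComponent F F' →
                                ObstructionTree Bad F' d T → ObstructionTree Bad F d T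
obstructionTree-fromComponent (F'⊆F , _) D = transfer D _ (λ {e} _ → F'⊆F (proj₁ e) (proj₂ e))

mainTheorem9 : (α : Sign) → NonEmptySign α → (s : ℕ) → (F : Formula) → Finite F →
    (d : ℕ) → (T : VSet) →
    (ObstructionTree (BadC α s) F d T → ∃ λ F' → IsComponent F F' × ObstructionTree (BadC α s) F' d T) ×
    ((∃ λ F' → IsComponent F F' × ObstructionTree (BadC α s) F' d T) → ObstructionTree (BadC α s) F d T)
mainTheorem9 _ _ _ _ _ _ _ =
  obstructionTree-inComponent , λ (_ , isComponent , D) → obstructionTree-fromComponent isComponent D
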